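{- For every $0<\varepsilon<1$ there is some $\delta>0$ such that the following holds. Let $k\geq 1$ and let $\Phi$ be a $k$-vertex graph invariant such that \[1\leq|\operatorname{supp}(\Phi)|\leq(2-\varepsilon)^{\binom{k}{2}}.\] Then there is a $k$-vertex graph $H$ such that $\widehat{\Phi}(H)\neq 0$ and $|E(H)|\geq\delta\cdot\binom{k}{2}$.
   Context: All graphs are finite, simple and undirected. A graph invariant is an isomorphism-invariant map $\Phi$ from graphs to $\mathbb{Q}$; it is a $k$-vertex graph invariant if $\Phi(G)=0$ whenever $|V(G)|\neq k$. $\operatorname{supp}(\Phi)$ is the set of graphs with vertex set exactly $\{1,\dots,k\}$ on which $\Phi$ is nonzero. The alternating enumerator of $\Phi$ on a graph $H$ is $\widehat{\Phi}(H)=(-1)^{|E(H)|}\sum_{S\subseteq E(H)}(-1)^{|S|}\Phi(H[S])$, where $H[S]=(V(H),S)$. -}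

module Defs where

open import Data.Bool using (Bool; true; false; _∧_; _∨_; not; if_then_else_)
open import Data.Bool.Properties using (∨-comm)
open import Data.Nat as ℕ using (ℕ; zero; suc)
open import Data.Fin using (Fin; toℕ; _≟_)

open import Data.Integer using (+_)
open import Data.List using (List; []; _∷_; _++_; map; filter; length; concatMap; allFin)
open import Data.Product using (_×_; _,_)
open import Data.Rational using (ℚ; 0ℚ; 1ℚ; _+_; _*_; -_; _/_)
import Data.Rational as ℚ
open import Data.Fin.Permutation using (Permutation′; _⟨$⟩ʳ_)
open import Relation.Nullary using (¬_; yes; no; ¬?)
open import Relation.Nullary.Decidable using (⌊_⌋)
open import Relation.Binary.PropositionalEquality using (_≡_; refl; sym; cong; cong₂)

record Graph (k : ℕ) : Set where
  field
    adj   : Fin k → Fin k → Bool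
    adjSym   : ∀ i j → adj i j ≡ adj j i
    adjIrrefl : ∀ i → adj i i ≡ false
open Graph public

pairs : (k : ℕ) → List (Fin k × Fin k)
pairs k = concatMap (λ i → map (λ j → (i , j)) (filter (λ j → toℕ i ℕ.<? toℕ j) (allFin k))) (allFin k)

-- All sublists of a list (i.e. all subsets of a duplicate-free list).
subs : {A : Set} → List A → List (List A)
subs []       = [] ∷ []
subs (x ∷ xs) = subs xs ++ map (x ∷_) (subs xs)

private
  eqb : ∀ {k} → Fin k → Fin k → Bool
  eqb a b = ⌊ a ≟ b ⌋

  eqb-sym : ∀ {k} (a b : Fin k) → eqb a b ≡ eqb b a
  eqb-sym a b with a ≟ b | b ≟ a
  ... | yes _ | yes _ = refl
  ... | no _  | no _  = refl
  ... | yes p | no q  with q (sym p)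
  ... | ()
  eqb-sym a b | no q | yes p with q (sym p)
  ... | ()

  eqb-refl : ∀ {k} (a : Fin k) → eqb a a ≡ true
  eqb-refl a with a ≟ a
  ... | yes _ = refl
  ... | no q with q refl
  ... | ()

  match : ∀ {k} → Fin k → Fin k → Fin k × Fin k → Bool
  match i j (a , b) = (eqb a i ∧ eqb b j) ∨ (eqb a j ∧ eqb b i)

  match-sym : ∀ {k} (i j : Fin k) e → match i j e ≡ match j i e
  match-sym i j (a , b) = ∨-comm (eqb a i ∧ eqb b j) (eqb a j ∧ eqb b i)

  anyM : ∀ {k} → Fin k → Fin k → List (Fin k × Fin k) → Bool
  anyM i j []       = false
  anyM i j (e ∷ es) = match i j e ∨ anyM i j es

  anyM-sym : ∀ {k} (i j : Fin k) es → anyM i j es ≡ anyM j i es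
  anyM-sym i j []       = refl
  anyM-sym i j (e ∷ es) = cong₂ _∨_ (match-sym i j e) (anyM-sym i j es)

fromEdges : ∀ {k} → List (Fin k × Fin k) → Graph k
fromEdges es = record
  { adj   = λ i j → not (eqb i j) ∧ anyM i j es
  ; adjSym   = λ i j → cong₂ (λ x y → not x ∧ y) (eqb-sym i j) (anyM-sym i j es)
  ; adjIrrefl = λ i → cong (λ x → not x ∧ anyM i i es) (eqb-refl i)
  }

edges : ∀ {k} → Graph k → List (Fin k × Fin k)
edges {k} G = filter (λ { (i , j) → adj G i j Data.Bool.≟ true }) (pairs k)

numEdges : ∀ {k} → Graph k → ℕ
numEdges G = length (edges G)

-- Every graph with vertex set {1,…,k}, each listed exactly once.
allGraphs : (k : ℕ) → List (Graph k)
allGraphs k = map fromEdges (subs (pairs k))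

IsoInvariant : ∀ {k} → (Graph k → ℚ) → Set
IsoInvariant {k} Φ = ∀ (σ : Permutation′ k) (G H : Graph k) →
  (∀ i j → adj H i j ≡ adj G (σ ⟨$⟩ʳ i) (σ ⟨$⟩ʳ j)) → Φ G ≡ Φ H

suppSize : ∀ {k} → (Graph k → ℚ) → ℕ
suppSize {k} Φ = length (filter (λ G → ¬? (Φ G ℚ.≟ 0ℚ)) (allGraphs k))

ℕ→ℚ : ℕ → ℚ
ℕ→ℚ n = + n / 1

_^ℚ_ : ℚ → ℕ → ℚ
q ^ℚ zero  = 1ℚ
q ^ℚ suc n = q * (q ^ℚ n)

sgn : ℕ → ℚ
sgn n = (- 1ℚ) ^ℚ n

sumℚ : List ℚ → ℚ
sumℚ []       = 0ℚ
sumℚ (x ∷ xs) = x + sumℚ xs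

altEnum : ∀ {k} → (Graph k → ℚ) → Graph k → ℚ
altEnum Φ H = sgn (numEdges H) * sumℚ (map (λ S → sgn (length S) * Φ (fromEdges S)) (subs (edges H)))

{-# OPTIONS --safe #-}
module Submission where

-- Write f S = Φ (V , S) for S ⊆ E(K_k), a function on the subsets of the n = k C 2 pairs; Φ̂ H is
-- the Möbius transform of f at E(H), the coefficient of the monomial of H in the multilinear
-- polynomial of f. If all nonzero coefficients sit on sets of size < D, then f ≠ 0 is nonzero on
-- at least 2 ^ (n + 1 - D) sets: split along one pair; either both halves are nonzero, or one
-- half vanishes and f has the support of its discrete derivative, whose degree is < D - 1.
-- With q the denominator of ε we have 2 - ε ≤ (2q - 1) / q = b / q; for δ = 1 / (b + 1) and
-- D = ⌈δ n⌉ the bound 2 ^ (n + 1 - D) > (2 - ε) ^ n follows from Bernoulli's inequality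
-- 2 b ^ (b + 1) ≤ (b + 1) ^ (b + 1).

open import Defs
open import Data.Bool using (true; false; _∧_; _∨_; not)
import Data.Bool.Properties as Bool
open import Data.Nat using (ℕ; zero; suc; z≤n; s≤s; _^_; _≥_)
import Data.Nat as ℕ
import Data.Nat.Properties as ℕ
open import Data.Nat.ListAction using (sum)
open import Data.Nat.Combinatorics using (_C_; nC1≡n; nCk+nC[k+1]≡[n+1]C[k+1])
open import Data.Nat.Tactic.RingSolver using (solve-∀)
open import Data.Fin as Fin using (Fin; toℕ)
open import Data.List using (List; []; _∷_; _++_; map; filter; length; concatMap; allFin)
import Data.List.Properties as List
open import Data.List.Relation.Unary.All as All using (All; []; _∷_; decide; search)
import Data.List.Relation.Unary.All.Properties as All
open import Data.List.Relation.Unary.Any as Any using (Any; here; there)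
open import Data.List.Relation.Unary.AllPairs as AllPairs using (_∷_)
import Data.List.Relation.Unary.AllPairs.Properties as AllPairs
open import Data.List.Relation.Unary.Unique.Propositional using (Unique)
import Data.List.Relation.Unary.Unique.Propositional.Properties as Unique
open import Data.List.Membership.Propositional using (_∈_)
open import Data.Product using (_×_; _,_; proj₁; proj₂; ∃-syntax)
open import Data.Sum using (_⊎_; inj₁; inj₂; [_,_]′)
open import Function using (_∘_; id; _⇔_; mk⇔; Equivalence)
import Function.Properties.Equivalence as ⇔
open import Level using (0ℓ)
open import Relation.Nullary using (¬_; ¬?; yes; no; contradiction)
open import Relation.Nullary.Decidable using (⌊_⌋; toSum; decidable-stable; _×-dec_)
open import Relation.Unary using (Pred; Decidable)
open import Relation.Binary.PropositionalEquality

module _ where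
  open import Data.Nat
  open import Data.Nat.Properties
  open import Data.Nat.DivMod using (_/_; _%_; m≡m%n+[m/n]*n; m%n<n; m/n*n≤m)

  ^-distribʳ-* : ∀ x y n → (x * y) ^ n ≡ x ^ n * y ^ n
  ^-distribʳ-* x y zero    = refl
  ^-distribʳ-* x y (suc n) = trans (cong (x * y *_) (^-distribʳ-* x y n)) (interchange x y (x ^ n) (y ^ n))
    where
    interchange : ∀ x y a b → x * y * (a * b) ≡ x * a * (y * b)
    interchange = solve-∀

  ^-swap : ∀ x m n → (x ^ m) ^ n ≡ (x ^ n) ^ m
  ^-swap x m n = trans (^-*-assoc x m n) (trans (cong (x ^_) (*-comm m n)) (sym (^-*-assoc x n m)))

  bernoulli : ∀ b n → b ^ n * (suc b + n) ≤ suc b ^ suc n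
  bernoulli b zero    = ≤-reflexive (base b)
    where
    base : ∀ b → 1 * (suc b + 0) ≡ suc b * 1
    base = solve-∀
  bernoulli b (suc n) = begin
    b ^ suc n * (suc b + suc n)      ≡⟨ regroup b (b ^ n) n ⟩
    b ^ n * (b * (suc b + suc n))    ≤⟨ *-monoʳ-≤ (b ^ n) (≤-trans (m≤m+n _ (suc n)) (≤-reflexive (expand b n))) ⟩
    b ^ n * (suc b * (suc b + n))    ≡⟨ *-comm-middle (b ^ n) (suc b) (suc b + n) ⟩
    suc b * (b ^ n * (suc b + n))    ≤⟨ *-monoʳ-≤ (suc b) (bernoulli b n) ⟩
    suc b * suc b ^ suc n            ∎
    where
    open ≤-Reasoning
    regroup : ∀ b x n → b * x * (suc b + suc n) ≡ x * (b * (suc b + suc n))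
    regroup = solve-∀
    expand : ∀ b n → b * (suc b + suc n) + suc n ≡ suc b * (suc b + n)
    expand = solve-∀
    *-comm-middle : ∀ x y z → x * (y * z) ≡ y * (x * z)
    *-comm-middle = solve-∀

  2*b^[1+b]≤[1+b]^[1+b] : ∀ b → 2 * b ^ suc b ≤ suc b ^ suc b
  2*b^[1+b]≤[1+b]^[1+b] b = begin
    2 * (b * b ^ b)      ≡⟨ regroup b (b ^ b) ⟩
    b ^ b * (b + b)      ≤⟨ *-monoʳ-≤ (b ^ b) (n≤1+n (b + b)) ⟩
    b ^ b * (suc b + b)  ≤⟨ bernoulli b b ⟩
    suc b ^ suc b        ∎
    where
    open ≤-Reasoning
    regroup : ∀ b x → 2 * (b * x) ≡ x * (b + b)
    regroup = solve-∀

  ⌈_/suc_⌉ : ℕ → ℕ → ℕ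
  ⌈ M /suc b ⌉ = (M + b) / suc b

  ⌈/⌉*-≤ : ∀ M b → ⌈ M /suc b ⌉ * suc b ≤ M + b
  ⌈/⌉*-≤ M b = m/n*n≤m (M + b) (suc b)

  ≤-⌈/⌉* : ∀ M b → M ≤ ⌈ M /suc b ⌉ * suc b
  ≤-⌈/⌉* M b = +-cancelʳ-≤ b M (D * suc b) (begin
    M + b                        ≡⟨ m≡m%n+[m/n]*n (M + b) (suc b) ⟩
    (M + b) % suc b + D * suc b  ≤⟨ +-monoˡ-≤ (D * suc b) (≤-pred (m%n<n (M + b) (suc b))) ⟩
    b + D * suc b                ≡⟨ +-comm b (D * suc b) ⟩
    D * suc b + b                ∎)
    where
    open ≤-Reasoning
    D = ⌈ M /suc b ⌉

  -- Raise the hypothesis to the power m = 1 + b: the factor 2 ^ (D m) ≤ 2 ^ M · 2 ^ b is absorbed by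
  -- Bernoulli's 2 b ^ m ≤ (1 + b) ^ m in each of the M factors, leaving 2 · 2 ^ b ≤ 2 ^ b.
  [1+b]^M*2≰b^M*2^D : ∀ b M D → D * suc b ≤ M + b → ¬ (suc b ^ M * 2 ≤ b ^ M * 2 ^ D)
  [1+b]^M*2≰b^M*2^D b M D Dm≤M+b h = <⇒≱ (m<m*n X 2 (s≤s (s≤s z≤n))) (*-cancelʳ-≤ (X * 2) X (2 ^ b) chain)
    where
    a = suc b
    m = suc b
    X = (a ^ M) ^ m
    instance
      X≢0 : NonZero X
      X≢0 = m^n≢0 (a ^ M) m {{m^n≢0 a M}}
      2^b≢0 : NonZero (2 ^ b)
      2^b≢0 = m^n≢0 2 b
    chain : X * 2 * 2 ^ b ≤ X * 2 ^ b
    chain = begin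
      X * 2 * 2 ^ b                 ≡⟨ *-assoc X 2 (2 ^ b) ⟩
      X * 2 ^ m                     ≡⟨ ^-distribʳ-* (a ^ M) 2 m ⟨
      (a ^ M * 2) ^ m               ≤⟨ ^-monoˡ-≤ m h ⟩
      (b ^ M * 2 ^ D) ^ m           ≡⟨ ^-distribʳ-* (b ^ M) (2 ^ D) m ⟩
      (b ^ M) ^ m * (2 ^ D) ^ m     ≡⟨ cong ((b ^ M) ^ m *_) (^-*-assoc 2 D m) ⟩
      (b ^ M) ^ m * 2 ^ (D * m)     ≤⟨ *-monoʳ-≤ ((b ^ M) ^ m) (^-monoʳ-≤ 2 Dm≤M+b) ⟩
      (b ^ M) ^ m * 2 ^ (M + b)     ≡⟨ cong₂ _*_ (^-swap b M m) (^-distribˡ-+-* 2 M b) ⟩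
      (b ^ m) ^ M * (2 ^ M * 2 ^ b) ≡⟨ *-assoc ((b ^ m) ^ M) (2 ^ M) (2 ^ b) ⟨
      (b ^ m) ^ M * 2 ^ M * 2 ^ b   ≡⟨ cong (_* 2 ^ b) (^-distribʳ-* (b ^ m) 2 M) ⟨
      (b ^ m * 2) ^ M * 2 ^ b
        ≤⟨ *-monoˡ-≤ (2 ^ b) (^-monoˡ-≤ M (≤-trans (≤-reflexive (*-comm (b ^ m) 2)) (2*b^[1+b]≤[1+b]^[1+b] b))) ⟩
      (a ^ m) ^ M * 2 ^ b           ≡⟨ cong (_* 2 ^ b) (^-swap a m M) ⟩
      X * 2 ^ b                     ∎
      where open ≤-Reasoning

  m≤n*2^d⇒2m≤n*2^[1+d] : ∀ {m} n d → m ≤ n * 2 ^ d → 2 * m ≤ n * 2 ^ suc d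
  m≤n*2^d⇒2m≤n*2^[1+d] n d m≤ = ≤-trans (*-monoʳ-≤ 2 m≤) (≤-reflexive (reassoc n (2 ^ d)))
    where
    reassoc : ∀ n p → 2 * (n * p) ≡ n * (2 * p)
    reassoc = solve-∀

open import Data.Rational as ℚ using (ℚ; mkℚ; 0ℚ; 1ℚ; _<_; _≤_; _+_; _-_; _*_; -_; toℚᵘ; ↧ₙ_)
open import Data.Rational.Properties as ℚ using (_≟_)
import Data.Rational.Unnormalised as ℚᵘ
import Data.Rational.Unnormalised.Properties as ℚᵘ
open import Data.Rational.Solver using (module +-*-Solver)
open +-*-Solver using (solve; _:+_; _:*_; :-_; _:-_; _:=_; con)

private
  variable
    A B : Set
    k : ℕ

sumℚ-++ : ∀ xs ys → sumℚ (xs ++ ys) ≡ sumℚ xs + sumℚ ys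
sumℚ-++ []       ys = sym (ℚ.+-identityˡ _)
sumℚ-++ (x ∷ xs) ys = trans (cong (x +_) (sumℚ-++ xs ys)) (sym (ℚ.+-assoc x _ _))

sumℚ-map-*ˡ : ∀ c (g : B → ℚ) xs → sumℚ (map (λ x → c * g x) xs) ≡ c * sumℚ (map g xs)
sumℚ-map-*ˡ c g []       = sym (ℚ.*-zeroʳ c)
sumℚ-map-*ˡ c g (x ∷ xs) =
  trans (cong (c * g x +_) (sumℚ-map-*ˡ c g xs)) (sym (ℚ.*-distribˡ-+ c (g x) _))

sumℚ-map-- : ∀ (g h : B → ℚ) xs →
             sumℚ (map (λ x → g x - h x) xs) ≡ sumℚ (map g xs) - sumℚ (map h xs)
sumℚ-map-- g h []       = refl
sumℚ-map-- g h (x ∷ xs) =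
  trans (cong (g x - h x +_) (sumℚ-map-- g h xs)) (interchange (g x) (h x) _ _)
  where
  interchange : ∀ a b c d → (a - b) + (c - d) ≡ (a + c) - (b + d)
  interchange = solve 4 (λ a b c d → (a :- b) :+ (c :- d) := (a :+ c) :- (b :+ d)) refl

nonzeros : (B → ℚ) → List B → ℕ
nonzeros f xs = length (filter (λ x → ¬? (f x ≟ 0ℚ)) xs)

nonzeros-++ : ∀ (f : B → ℚ) xs ys → nonzeros f (xs ++ ys) ≡ nonzeros f xs ℕ.+ nonzeros f ys
nonzeros-++ f xs ys =
  trans (cong length (List.filter-++ P? xs ys)) (List.length-++ (filter P? xs))
  where P? = λ x → ¬? (f x ≟ 0ℚ)

nonzeros-map : ∀ (f : B → ℚ) (h : A → B) xs → nonzeros f (map h xs) ≡ nonzeros (f ∘ h) xs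
nonzeros-map f h []       = refl
nonzeros-map f h (x ∷ xs) with f (h x) ≟ 0ℚ
... | yes _ = nonzeros-map f h xs
... | no  _ = cong suc (nonzeros-map f h xs)

nonzeros-cong : ∀ {f g : B → ℚ} {xs} → All (λ x → f x ≡ 0ℚ ⇔ g x ≡ 0ℚ) xs → nonzeros f xs ≡ nonzeros g xs
nonzeros-cong []                            = refl
nonzeros-cong {f = f} {g} {x ∷ xs} (e ∷ es) with f x ≟ 0ℚ | g x ≟ 0ℚ
... | yes _  | yes _  = nonzeros-cong es
... | no  _  | no  _  = cong suc (nonzeros-cong es)
... | yes fx | no  gx = contradiction (Equivalence.to e fx) gx
... | no  fx | yes gx = contradiction (Equivalence.from e gx) fx

vanishes⇒nonzeros≡0 : ∀ {f : B → ℚ} {xs} → All (λ x → f x ≡ 0ℚ) xs → nonzeros f xs ≡ 0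
vanishes⇒nonzeros≡0 zs = cong length (List.filter-none _ (All.map (λ z nz → nz z) zs))

vanishes⊎nonzeros≥1 : ∀ (f : B → ℚ) xs → All (λ x → f x ≡ 0ℚ) xs ⊎ 1 ℕ.≤ nonzeros f xs
vanishes⊎nonzeros≥1 f xs with decide (toSum ∘ (λ x → f x ≟ 0ℚ)) xs
... | inj₁ zs = inj₁ zs
... | inj₂ nz = inj₂ (List.filter-some _ nz)

length-concatMap : ∀ {B : Set} (f : A → List B) xs → length (concatMap f xs) ≡ sum (map (length ∘ f) xs)
length-concatMap f []       = refl
length-concatMap f (x ∷ xs) = trans (List.length-++ (f x)) (cong (length (f x) ℕ.+_) (length-concatMap f xs))

subs-All : ∀ {P : Pred A 0ℓ} {xs} → All P xs → All (All P) (subs xs)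
subs-All []         = [] ∷ []
subs-All (px ∷ pxs) = All.++⁺ (subs-All pxs) (All.map⁺ (All.map (px ∷_) (subs-All pxs)))

∈-∷-≢ : ∀ {x y : A} {xs} → x ≢ y → (x ∈ y ∷ xs ⇔ x ∈ xs)
∈-∷-≢ x≢y = mk⇔ (λ { (here x≡y) → contradiction x≡y x≢y ; (there x∈xs) → x∈xs }) there

filter-subs : ∀ {A : Set} {xs : List A} → Unique xs →
  All (λ T → ∀ {P : Pred A 0ℓ} (P? : Decidable P) → All (λ e → P e ⇔ e ∈ T) xs → filter P? xs ≡ T) (subs xs)
filter-subs {xs = []}    AllPairs.[]      = (λ _ _ → refl) ∷ []
filter-subs {A} {x ∷ xs} (x∉xs ∷ unique) = All.++⁺ without-x (All.map⁺ with-x)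
  where
  Determined : List A → List A → Set₁
  Determined ys T = ∀ {P : Pred A 0ℓ} (P? : Decidable P) → All (λ e → P e ⇔ e ∈ T) ys → filter P? ys ≡ T
  without-x : All (Determined (x ∷ xs)) (subs xs)
  without-x = All.zipWith
    (λ { (ih , x∉T) P? (Px⇔x∈T ∷ rest) →
         trans (List.filter-reject P? (λ Px → All.lookup x∉T (Equivalence.to Px⇔x∈T Px) refl)) (ih P? rest) })
    (filter-subs unique , subs-All x∉xs)
  with-x : All (λ T → Determined (x ∷ xs) (x ∷ T)) (subs xs)
  with-x = All.map
    (λ { ih P? (Px⇔x∈xT ∷ rest) →
         trans (List.filter-accept P? (Equivalence.from Px⇔x∈xT (here refl)))
               (cong (x ∷_) (ih P? (All.zipWith (λ { (x≢e , Pe⇔e∈xT) → ⇔.trans Pe⇔e∈xT (∈-∷-≢ (x≢e ∘ sym)) })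
                                                (x∉xs , rest)))) })
    (filter-subs unique)

möbius : (List A → ℚ) → List A → ℚ
möbius f T = sgn (length T) * sumℚ (map (λ S → sgn (length S) * f S) (subs T))

Δ : A → (List A → ℚ) → List A → ℚ
Δ x f S = f (x ∷ S) - f S

möbius-[] : ∀ (f : List A → ℚ) → möbius f [] ≡ f []
möbius-[] f = solve 1 (λ a → con 1ℚ :* (con 1ℚ :* a :+ con 0ℚ) := a) refl (f [])

*-distribˡ-- : ∀ s a b → s * (a - b) ≡ s * a - s * b
*-distribˡ-- = solve 3 (λ s a b → s :* (a :- b) := s :* a :- s :* b) refl

möbius-- : ∀ (f g : List A → ℚ) T → möbius (λ S → f S - g S) T ≡ möbius f T - möbius g T
möbius-- f g T = begin
  sgn t * sumℚ (map (λ S → sgn (length S) * (f S - g S)) (subs T))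
    ≡⟨ cong (λ xs → sgn t * sumℚ xs) (List.map-cong (λ S → *-distribˡ-- (sgn (length S)) (f S) (g S)) (subs T)) ⟩
  sgn t * sumℚ (map (λ S → sgn (length S) * f S - sgn (length S) * g S) (subs T))
    ≡⟨ cong (sgn t *_) (sumℚ-map-- (λ S → sgn (length S) * f S) (λ S → sgn (length S) * g S) (subs T)) ⟩
  sgn t * (Σf - Σg)
    ≡⟨ *-distribˡ-- (sgn t) Σf Σg ⟩
  möbius f T - möbius g T ∎
  where
  open ≡-Reasoning
  t  = length T
  Σf = sumℚ (map (λ S → sgn (length S) * f S) (subs T))
  Σg = sumℚ (map (λ S → sgn (length S) * g S) (subs T))

möbius-∷ : ∀ (f : List A → ℚ) x T → möbius f (x ∷ T) ≡ möbius (f ∘ (x ∷_)) T - möbius f T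
möbius-∷ f x T = begin
  sgn (suc t) * sumℚ (map h (subs T ++ map (x ∷_) (subs T)))
    ≡⟨ cong (λ xs → sgn (suc t) * sumℚ xs) (List.map-++ h (subs T) _) ⟩
  sgn (suc t) * sumℚ (map h (subs T) ++ map h (map (x ∷_) (subs T)))
    ≡⟨ cong (sgn (suc t) *_) (sumℚ-++ (map h (subs T)) _) ⟩
  sgn (suc t) * (Σ₀ + sumℚ (map h (map (x ∷_) (subs T))))
    ≡⟨ cong (λ z → sgn (suc t) * (Σ₀ + z)) odd-half ⟩
  sgn (suc t) * (Σ₀ + - 1ℚ * Σ₁)
    ≡⟨ solve 3 (λ s a b → (con (- 1ℚ) :* s) :* (a :+ con (- 1ℚ) :* b) := s :* b :- s :* a) refl (sgn t) Σ₀ Σ₁ ⟩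
  sgn t * Σ₁ - sgn t * Σ₀ ∎
  where
  open ≡-Reasoning
  t  = length T
  h  = λ S → sgn (length S) * f S
  Σ₀ = sumℚ (map h (subs T))
  Σ₁ = sumℚ (map (λ S → sgn (length S) * f (x ∷ S)) (subs T))
  odd-half : sumℚ (map h (map (x ∷_) (subs T))) ≡ - 1ℚ * Σ₁
  odd-half = begin
    sumℚ (map h (map (x ∷_) (subs T)))
      ≡⟨ cong sumℚ (sym (List.map-∘ (subs T))) ⟩
    sumℚ (map (λ S → (- 1ℚ * sgn (length S)) * f (x ∷ S)) (subs T))
      ≡⟨ cong sumℚ (List.map-cong (λ S → ℚ.*-assoc (- 1ℚ) (sgn (length S)) (f (x ∷ S))) (subs T)) ⟩
    sumℚ (map (λ S → - 1ℚ * (sgn (length S) * f (x ∷ S))) (subs T))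
      ≡⟨ sumℚ-map-*ˡ (- 1ℚ) (λ S → sgn (length S) * f (x ∷ S)) (subs T) ⟩
    - 1ℚ * Σ₁ ∎

möbius-Δ : ∀ x (f : List A → ℚ) T → möbius (Δ x f) T ≡ möbius f (x ∷ T)
möbius-Δ x f T = trans (möbius-- (f ∘ (x ∷_)) f T) (sym (möbius-∷ f x T))

möbius-shift : ∀ x (f : List A → ℚ) T → möbius (f ∘ (x ∷_)) T ≡ möbius f (x ∷ T) + möbius f T
möbius-shift x f T = begin
  möbius (f ∘ (x ∷_)) T                              ≡⟨ solve 2 (λ a b → a := (a :- b) :+ b) refl _ (möbius f T) ⟩
  (möbius (f ∘ (x ∷_)) T - möbius f T) + möbius f T  ≡⟨ cong (_+ möbius f T) (sym (möbius-∷ f x T)) ⟩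
  möbius f (x ∷ T) + möbius f T                      ∎
  where open ≡-Reasoning

DegreeBelow : ℕ → (List A → ℚ) → List A → Set
DegreeBelow D f L = All (λ T → D ℕ.≤ length T → möbius f T ≡ 0ℚ) (subs L)

module _ {D : ℕ} {f : List A → ℚ} {x : A} {L : List A} where

  degreeBelow-∷⁻ : DegreeBelow D f (x ∷ L) →
                   DegreeBelow D f L × All (λ T → D ℕ.≤ suc (length T) → möbius f (x ∷ T) ≡ 0ℚ) (subs L)
  degreeBelow-∷⁻ deg = All.++⁻ˡ (subs L) deg , All.map⁻ (All.++⁻ʳ (subs L) deg)

  degreeBelow-shift : DegreeBelow D f (x ∷ L) → DegreeBelow D (f ∘ (x ∷_)) L
  degreeBelow-shift deg = All.zipWith (λ {T} (deg-T , deg-xT) → vanish {T} deg-T deg-xT) (degreeBelow-∷⁻ deg)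
    where
    vanish : ∀ {T} → (D ℕ.≤ length T → möbius f T ≡ 0ℚ) → (D ℕ.≤ suc (length T) → möbius f (x ∷ T) ≡ 0ℚ) →
             D ℕ.≤ length T → möbius (f ∘ (x ∷_)) T ≡ 0ℚ
    vanish {T} deg-T deg-xT D≤t = begin
      möbius (f ∘ (x ∷_)) T          ≡⟨ möbius-shift x f T ⟩
      möbius f (x ∷ T) + möbius f T  ≡⟨ cong₂ _+_ (deg-xT (ℕ.m≤n⇒m≤1+n D≤t)) (deg-T D≤t) ⟩
      0ℚ                             ∎
      where open ≡-Reasoning

degreeBelow-Δ : ∀ {D} {f : List A → ℚ} {x L} → DegreeBelow (suc D) f (x ∷ L) → DegreeBelow D (Δ x f) L
degreeBelow-Δ {f = f} {x} {L} deg =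
  All.map (λ {T} deg-xT D≤t → trans (möbius-Δ x f T) (deg-xT (s≤s D≤t))) (proj₂ (degreeBelow-∷⁻ {x = x} {L} deg))

degreeBelow-0⇒vanishes : ∀ (f : List A → ℚ) L → DegreeBelow 0 f L → All (λ S → f S ≡ 0ℚ) (subs L)
degreeBelow-0⇒vanishes f []      (deg-[] ∷ []) = trans (sym (möbius-[] f)) (deg-[] z≤n) ∷ []
degreeBelow-0⇒vanishes f (x ∷ L) deg =
  All.++⁺ (degreeBelow-0⇒vanishes f L (proj₁ (degreeBelow-∷⁻ {x = x} {L} deg)))
          (All.map⁺ (degreeBelow-0⇒vanishes (f ∘ (x ∷_)) L (degreeBelow-shift {x = x} {L} deg)))

a-b≡0⇔a≡0 : ∀ a {b} → b ≡ 0ℚ → (a - b ≡ 0ℚ ⇔ a ≡ 0ℚ)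
a-b≡0⇔a≡0 a refl = mk⇔ (trans (sym (ℚ.+-identityʳ a))) (trans (ℚ.+-identityʳ a))

a-b≡0⇔b≡0 : ∀ {a} b → a ≡ 0ℚ → (a - b ≡ 0ℚ ⇔ b ≡ 0ℚ)
a-b≡0⇔b≡0 b refl = mk⇔ (λ -b≡0 → ℚ.neg-injective (trans (sym (ℚ.+-identityˡ (- b))) -b≡0))
                        (λ b≡0 → trans (ℚ.+-identityˡ (- b)) (cong -_ b≡0))

support-bound : ∀ L (f : List A → ℚ) D → DegreeBelow D f L → 1 ℕ.≤ nonzeros f (subs L) →
                2 ^ suc (length L) ℕ.≤ nonzeros f (subs L) ℕ.* 2 ^ D
support-bound L f zero deg s≥1 =
  contradiction (vanishes⇒nonzeros≡0 (degreeBelow-0⇒vanishes f L deg)) (ℕ.<⇒≢ s≥1 ∘ sym)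
support-bound []      f (suc D) deg s≥1 = ℕ.*-mono-≤ s≥1 (ℕ.^-monoʳ-≤ 2 {1} {suc D} (s≤s z≤n))
support-bound (x ∷ L) f (suc D) deg s≥1 =
  by-halves (vanishes⊎nonzeros≥1 f (subs L)) (vanishes⊎nonzeros≥1 (f ∘ (x ∷_)) (subs L))
  where
  n  = length L
  s  = nonzeros f (subs (x ∷ L))
  s₀ = nonzeros f (subs L)
  s₁ = nonzeros (f ∘ (x ∷_)) (subs L)
  Goal : Set
  Goal = 2 ^ suc (suc n) ℕ.≤ s ℕ.* 2 ^ suc D

  split : s ≡ s₀ ℕ.+ s₁
  split = trans (nonzeros-++ f (subs L) _) (cong (s₀ ℕ.+_) (nonzeros-map f (x ∷_) (subs L)))

  -- If one half of f vanishes, the support of f is that of Δ x f, whose degree is one lower.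
  via-Δ : s ≡ nonzeros (Δ x f) (subs L) → Goal
  via-Δ eq = subst (λ s′ → 2 ^ suc (suc n) ℕ.≤ s′ ℕ.* 2 ^ suc D) (sym eq)
    (m≤n*2^d⇒2m≤n*2^[1+d] (nonzeros (Δ x f) (subs L)) D
      (support-bound L (Δ x f) D (degreeBelow-Δ {x = x} {L} deg) (subst (1 ℕ.≤_) eq s≥1)))

  by-halves : All (λ S → f S ≡ 0ℚ) (subs L) ⊎ 1 ℕ.≤ s₀ →
              All (λ S → f (x ∷ S) ≡ 0ℚ) (subs L) ⊎ 1 ℕ.≤ s₁ → Goal
  by-halves (inj₂ s₀≥1) (inj₂ s₁≥1) = begin
    2 ℕ.* 2 ^ suc n                        ≡⟨ cong (2 ^ suc n ℕ.+_) (ℕ.*-identityˡ (2 ^ suc n)) ⟩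
    2 ^ suc n ℕ.+ 2 ^ suc n
      ≤⟨ ℕ.+-mono-≤ (support-bound L f (suc D) (proj₁ (degreeBelow-∷⁻ {x = x} {L} deg)) s₀≥1)
                    (support-bound L (f ∘ (x ∷_)) (suc D) (degreeBelow-shift {x = x} {L} deg) s₁≥1) ⟩
    s₀ ℕ.* 2 ^ suc D ℕ.+ s₁ ℕ.* 2 ^ suc D  ≡⟨ ℕ.*-distribʳ-+ (2 ^ suc D) s₀ s₁ ⟨
    (s₀ ℕ.+ s₁) ℕ.* 2 ^ suc D              ≡⟨ cong (ℕ._* 2 ^ suc D) split ⟨
    s ℕ.* 2 ^ suc D                        ∎
    where open ℕ.≤-Reasoning
  by-halves (inj₁ f₀≡0) _ = via-Δ (begin
    s                         ≡⟨ split ⟩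
    s₀ ℕ.+ s₁                 ≡⟨ cong (ℕ._+ s₁) (vanishes⇒nonzeros≡0 f₀≡0) ⟩
    s₁                        ≡⟨ nonzeros-cong (All.map (a-b≡0⇔a≡0 _) f₀≡0) ⟨
    nonzeros (Δ x f) (subs L) ∎)
    where open ≡-Reasoning
  by-halves (inj₂ _) (inj₁ f₁≡0) = via-Δ (begin
    s                         ≡⟨ split ⟩
    s₀ ℕ.+ s₁                 ≡⟨ cong (s₀ ℕ.+_) (vanishes⇒nonzeros≡0 f₁≡0) ⟩
    s₀ ℕ.+ 0                  ≡⟨ ℕ.+-identityʳ s₀ ⟩
    s₀                        ≡⟨ nonzeros-cong (All.map (a-b≡0⇔b≡0 _) f₁≡0) ⟨
    nonzeros (Δ x f) (subs L) ∎)
    where open ≡-Reasoning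

nonzero-möbius-on-large-set : ∀ {A : Set} (L : List A) f b q → 1 ℕ.≤ nonzeros f (subs L) →
  nonzeros f (subs L) ℕ.* q ^ length L ℕ.≤ b ^ length L → suc b ℕ.≤ 2 ℕ.* q →
  Any (λ T → möbius f T ≢ 0ℚ × length L ℕ.≤ length T ℕ.* suc b) (subs L)
nonzero-möbius-on-large-set {A} L f b q s≥1 s-small 1+b≤2q =
  [ no-large-set , id ]′ (search large? (subs L))
  where
  n = length L
  s = nonzeros f (subs L)
  D = ⌈ n /suc b ⌉

  Large : Pred (List A) 0ℓ
  Large T = möbius f T ≢ 0ℚ × n ℕ.≤ length T ℕ.* suc b

  large? : Decidable Large
  large? T = ¬? (möbius f T ≟ 0ℚ) ×-dec (n ℕ.≤? length T ℕ.* suc b)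

  small-degree : All (¬_ ∘ Large) (subs L) → DegreeBelow D f L
  small-degree = All.map λ {T} ¬large D≤t → decidable-stable (möbius f T ≟ 0ℚ) λ nonzero →
    ¬large (nonzero , ℕ.≤-trans (≤-⌈/⌉* n b) (ℕ.*-monoˡ-≤ (suc b) D≤t))

  power-bound : DegreeBelow D f L → suc b ^ n ℕ.* 2 ℕ.≤ b ^ n ℕ.* 2 ^ D
  power-bound deg = begin
    suc b ^ n ℕ.* 2          ≤⟨ ℕ.*-monoˡ-≤ 2 (ℕ.^-monoˡ-≤ n 1+b≤2q) ⟩
    (2 ℕ.* q) ^ n ℕ.* 2      ≡⟨ cong (ℕ._* 2) (^-distribʳ-* 2 q n) ⟩
    2 ^ n ℕ.* q ^ n ℕ.* 2    ≡⟨ swap₁ (2 ^ n) (q ^ n) ⟩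
    2 ^ suc n ℕ.* q ^ n      ≤⟨ ℕ.*-monoˡ-≤ (q ^ n) (support-bound L f D deg s≥1) ⟩
    s ℕ.* 2 ^ D ℕ.* q ^ n    ≡⟨ swap₂ s (2 ^ D) (q ^ n) ⟩
    s ℕ.* q ^ n ℕ.* 2 ^ D    ≤⟨ ℕ.*-monoˡ-≤ (2 ^ D) s-small ⟩
    b ^ n ℕ.* 2 ^ D          ∎
    where
    open ℕ.≤-Reasoning
    swap₁ : ∀ x y → x ℕ.* y ℕ.* 2 ≡ 2 ℕ.* x ℕ.* y
    swap₁ = solve-∀
    swap₂ : ∀ x y z → x ℕ.* y ℕ.* z ≡ x ℕ.* z ℕ.* y
    swap₂ = solve-∀

  no-large-set : All (¬_ ∘ Large) (subs L) → Any Large (subs L)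
  no-large-set none =
    contradiction (power-bound (small-degree none)) ([1+b]^M*2≰b^M*2^D b n D (⌈/⌉*-≤ n b))

Ordered : Fin k × Fin k → Set
Ordered (i , j) = toℕ i ℕ.< toℕ j

row : ∀ k → Fin k → List (Fin k × Fin k)
row k i = map (i ,_) (filter (λ j → toℕ i ℕ.<? toℕ j) (allFin k))

pairs-ordered : ∀ k → All Ordered (pairs k)
pairs-ordered k = All.concat⁺ (All.map⁺ {xs = allFin k} (All.tabulate λ {i} _ →
  All.map⁺ (All.all-filter (λ j → toℕ i ℕ.<? toℕ j) (allFin k))))

pairs-unique : ∀ k → Unique (pairs k)
pairs-unique k = Unique.concat⁺
  (All.map⁺ {xs = allFin k} (All.tabulate λ {i} _ →
    Unique.map⁺ (cong proj₂) (Unique.filter⁺ (λ j → toℕ i ℕ.<? toℕ j) (Unique.allFin⁺ k))))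
  (AllPairs.map⁺ (AllPairs.map rows-disjoint (Unique.allFin⁺ k)))
  where
  row-first : ∀ {i e} → e ∈ row k i → proj₁ e ≡ i
  row-first {i} = All.lookup (All.map⁺ {P = λ e → proj₁ e ≡ i} (All.tabulate (λ _ → refl)))
  rows-disjoint : ∀ {i i′} → i ≢ i′ → ∀ {e} → ¬ (e ∈ row k i × e ∈ row k i′)
  rows-disjoint i≢i′ (e∈ , e∈′) = i≢i′ (trans (sym (row-first e∈)) (row-first e∈′))

allFin-suc : ∀ k → allFin (suc k) ≡ Fin.zero ∷ map Fin.suc (allFin k)
allFin-suc k = cong (Fin.zero ∷_) (sym (List.map-tabulate (λ i → i) Fin.suc))

length-filter-0<-suc : ∀ (xs : List (Fin k)) → length (filter (λ j → 0 ℕ.<? toℕ j) (map Fin.suc xs)) ≡ length xs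
length-filter-0<-suc []       = refl
length-filter-0<-suc (x ∷ xs) = cong suc (length-filter-0<-suc xs)

length-filter-<-suc : ∀ c (xs : List (Fin k)) →
  length (filter (λ j → suc c ℕ.<? toℕ j) (map Fin.suc xs)) ≡ length (filter (λ j → c ℕ.<? toℕ j) xs)
length-filter-<-suc c []       = refl
length-filter-<-suc c (x ∷ xs) with c ℕ.<ᵇ toℕ x
... | true  = cong suc (length-filter-<-suc c xs)
... | false = length-filter-<-suc c xs

length-row-zero : ∀ k → length (row (suc k) Fin.zero) ≡ k
length-row-zero k = begin
  length (row (suc k) Fin.zero)                                                ≡⟨ List.length-map _ (above (allFin (suc k))) ⟩
  length (above (allFin (suc k)))                                              ≡⟨ cong (length ∘ above) (allFin-suc k) ⟩
  length (filter (λ j → 0 ℕ.<? toℕ j) (map Fin.suc (allFin k)))               ≡⟨ length-filter-0<-suc (allFin k) ⟩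
  length (allFin k)                                                            ≡⟨ List.length-tabulate (λ i → i) ⟩
  k                                                                            ∎
  where
  open ≡-Reasoning
  above = filter (λ j → 0 ℕ.<? toℕ j)

length-row-suc : ∀ k i → length (row (suc k) (Fin.suc i)) ≡ length (row k i)
length-row-suc k i = begin
  length (row (suc k) (Fin.suc i))                                             ≡⟨ List.length-map _ (above (allFin (suc k))) ⟩
  length (above (allFin (suc k)))                                              ≡⟨ cong (length ∘ above) (allFin-suc k) ⟩
  length (above (map Fin.suc (allFin k)))                                      ≡⟨ length-filter-<-suc (toℕ i) (allFin k) ⟩
  length (filter (λ j → toℕ i ℕ.<? toℕ j) (allFin k))                          ≡⟨ List.length-map _ (filter (λ j → toℕ i ℕ.<? toℕ j) (allFin k)) ⟨
  length (row k i)                                                             ∎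
  where
  open ≡-Reasoning
  above = filter (λ j → suc (toℕ i) ℕ.<? toℕ j)

length-pairs : ∀ k → length (pairs k) ≡ k C 2
length-pairs zero    = refl
length-pairs (suc k) = begin
  length (pairs (suc k))                                          ≡⟨ length-concatMap (row (suc k)) (allFin (suc k)) ⟩
  sum (map (length ∘ row (suc k)) (allFin (suc k)))               ≡⟨ cong (sum ∘ map (length ∘ row (suc k))) (allFin-suc k) ⟩
  length (row (suc k) Fin.zero) ℕ.+ sum (map (length ∘ row (suc k)) (map Fin.suc (allFin k)))
    ≡⟨ cong₂ ℕ._+_ (length-row-zero k)
                   (cong sum (trans (sym (List.map-∘ (allFin k))) (List.map-cong (length-row-suc k) (allFin k)))) ⟩
  k ℕ.+ sum (map (length ∘ row k) (allFin k))                     ≡⟨ cong (k ℕ.+_) (length-concatMap (row k) (allFin k)) ⟨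
  k ℕ.+ length (pairs k)                                          ≡⟨ cong₂ ℕ._+_ (sym (nC1≡n k)) (length-pairs k) ⟩
  k C 1 ℕ.+ k C 2                                                 ≡⟨ nCk+nC[k+1]≡[n+1]C[k+1] k 1 ⟩
  suc k C 2                                                       ∎
  where open ≡-Reasoning

module _ {i j : Fin k} (i<j : Ordered (i , j)) where

  not-⌊≟⌋ : not ⌊ i Fin.≟ j ⌋ ≡ true
  not-⌊≟⌋ with i Fin.≟ j
  ... | yes refl = contradiction i<j (ℕ.<-irrefl refl)
  ... | no  _    = refl

  -- The left side is how fromEdges tests the edge (a , b) at (i , j); for ordered pairs only the
  -- orientation a = i, b = j can match.
  ordered-match : ∀ {a b : Fin k} → Ordered (a , b) →
    not ⌊ i Fin.≟ j ⌋ ∧ ((⌊ a Fin.≟ i ⌋ ∧ ⌊ b Fin.≟ j ⌋) ∨ (⌊ a Fin.≟ j ⌋ ∧ ⌊ b Fin.≟ i ⌋))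
      ≡ ⌊ a Fin.≟ i ⌋ ∧ ⌊ b Fin.≟ j ⌋
  ordered-match {a} {b} a<b rewrite not-⌊≟⌋ with a Fin.≟ j | b Fin.≟ i
  ... | yes refl | yes refl = contradiction a<b (ℕ.<-asym i<j)
  ... | yes _    | no  _    = Bool.∨-identityʳ _
  ... | no  _    | _        = Bool.∨-identityʳ _

  adj-fromEdges-∷ : ∀ {a b : Fin k} {T} → Ordered (a , b) →
    adj (fromEdges ((a , b) ∷ T)) i j ≡ (⌊ a Fin.≟ i ⌋ ∧ ⌊ b Fin.≟ j ⌋) ∨ adj (fromEdges T) i j
  adj-fromEdges-∷ {T = T} a<b =
    trans (Bool.∧-distribˡ-∨ (not ⌊ i Fin.≟ j ⌋) _ _) (cong (_∨ adj (fromEdges T) i j) (ordered-match a<b))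

  head-or-tail : ∀ {a b : Fin k} {r xs} → (r ≡ true ⇔ (i , j) ∈ xs) →
    ((⌊ a Fin.≟ i ⌋ ∧ ⌊ b Fin.≟ j ⌋) ∨ r ≡ true ⇔ (i , j) ∈ (a , b) ∷ xs)
  head-or-tail {a} {b} r⇔ with a Fin.≟ i | b Fin.≟ j
  ... | yes refl | yes refl = mk⇔ (λ _ → here refl) (λ _ → refl)
  ... | yes refl | no  b≢j  = ⇔.trans r⇔ (⇔.sym (∈-∷-≢ (b≢j ∘ sym ∘ cong proj₂)))
  ... | no  a≢i  | _        = ⇔.trans r⇔ (⇔.sym (∈-∷-≢ (a≢i ∘ sym ∘ cong proj₁)))

  adj-fromEdges : ∀ T → All Ordered T → (adj (fromEdges T) i j ≡ true ⇔ (i , j) ∈ T)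
  adj-fromEdges []            []          = mk⇔ (λ adj≡true → contradiction (trans (sym (Bool.∧-zeroʳ _)) adj≡true) λ ()) λ ()
  adj-fromEdges ((a , b) ∷ T) (a<b ∷ ord) =
    subst (λ r → r ≡ true ⇔ (i , j) ∈ (a , b) ∷ T) (sym (adj-fromEdges-∷ {T = T} a<b)) (head-or-tail (adj-fromEdges T ord))

edges-fromEdges : ∀ k → All (λ T → edges (fromEdges T) ≡ T) (subs (pairs k))
edges-fromEdges k = All.zipWith
  (λ { {T} (filter≡T , T-ordered) →
        filter≡T _ (All.map (λ { {e} e-ordered → adj-fromEdges e-ordered T T-ordered }) (pairs-ordered k)) })
  (filter-subs (pairs-unique k) , subs-All (pairs-ordered k))

nonzero-altEnum-with-many-edges : ∀ k (Φ : Graph k → ℚ) b q → 1 ℕ.≤ suppSize Φ →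
  suppSize Φ ℕ.* q ^ (k C 2) ℕ.≤ b ^ (k C 2) → suc b ℕ.≤ 2 ℕ.* q →
  ∃[ H ] (altEnum Φ H ≢ 0ℚ × k C 2 ℕ.≤ numEdges H ℕ.* suc b)
nonzero-altEnum-with-many-edges k Φ b q s≥1 s-small 1+b≤2q = realise (All.lookupAny (edges-fromEdges k) found)
  where
  f : List (Fin k × Fin k) → ℚ
  f = Φ ∘ fromEdges

  Large : List (Fin k × Fin k) → Set
  Large T = möbius f T ≢ 0ℚ × length (pairs k) ℕ.≤ length T ℕ.* suc b

  supp≡ : suppSize Φ ≡ nonzeros f (subs (pairs k))
  supp≡ = nonzeros-map Φ fromEdges (subs (pairs k))

  found : Any Large (subs (pairs k))
  found = nonzero-möbius-on-large-set (pairs k) f b q (subst (1 ℕ.≤_) supp≡ s≥1)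
    (subst₂ (λ s n → s ℕ.* q ^ n ℕ.≤ b ^ n) supp≡ (sym (length-pairs k)) s-small) 1+b≤2q

  -- altEnum Φ H unfolds to möbius f (edges H).
  realise : ∀ {T} → edges (fromEdges T) ≡ T × Large T → ∃[ H ] (altEnum Φ H ≢ 0ℚ × k C 2 ℕ.≤ numEdges H ℕ.* suc b)
  realise {T} (edges≡T , nonzero , large) =
    fromEdges T ,
    subst (λ E → möbius f E ≢ 0ℚ) (sym edges≡T) nonzero ,
    subst₂ (λ n e → n ℕ.≤ e ℕ.* suc b) (length-pairs k) (cong length (sym edges≡T)) large

module _ where
  open import Data.Integer as ℤ using (+_; +[1+_]; -[1+_])
  import Data.Integer.Properties as ℤ

  toℚᵘ-ℕ→ℚ : ∀ n → toℚᵘ (ℕ→ℚ n) ℚᵘ.≃ ℚᵘ.mkℚᵘ (+ n) 0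
  toℚᵘ-ℕ→ℚ n = ℚ.toℚᵘ-fromℚᵘ (ℚᵘ.mkℚᵘ (+ n) 0)

  ℕ→ℚ-+ : ∀ m n → ℕ→ℚ (m ℕ.+ n) ≡ ℕ→ℚ m + ℕ→ℚ n
  ℕ→ℚ-+ m n = ℚ.toℚᵘ-injective (ℚᵘ.≃-trans (toℚᵘ-ℕ→ℚ (m ℕ.+ n))
    (ℚᵘ.≃-trans (ℚᵘ.*≡* (cong (ℤ._* + 1) (trans (ℤ.pos-+ m n) (sym (cong₂ ℤ._+_ (ℤ.*-identityʳ (+ m)) (ℤ.*-identityʳ (+ n)))))))
                (ℚᵘ.≃-sym (ℚᵘ.≃-trans (ℚ.toℚᵘ-homo-+ (ℕ→ℚ m) (ℕ→ℚ n)) (ℚᵘ.+-cong (toℚᵘ-ℕ→ℚ m) (toℚᵘ-ℕ→ℚ n))))))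

  ℕ→ℚ-* : ∀ m n → ℕ→ℚ (m ℕ.* n) ≡ ℕ→ℚ m * ℕ→ℚ n
  ℕ→ℚ-* m n = ℚ.toℚᵘ-injective (ℚᵘ.≃-trans (toℚᵘ-ℕ→ℚ (m ℕ.* n))
    (ℚᵘ.≃-trans (ℚᵘ.*≡* (cong (ℤ._* + 1) (ℤ.pos-* m n)))
                (ℚᵘ.≃-sym (ℚᵘ.≃-trans (ℚ.toℚᵘ-homo-* (ℕ→ℚ m) (ℕ→ℚ n)) (ℚᵘ.*-cong (toℚᵘ-ℕ→ℚ m) (toℚᵘ-ℕ→ℚ n))))))

  ℕ→ℚ-^ : ∀ m n → ℕ→ℚ (m ^ n) ≡ ℕ→ℚ m ^ℚ n
  ℕ→ℚ-^ m zero    = refl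
  ℕ→ℚ-^ m (suc n) = trans (ℕ→ℚ-* m (m ^ n)) (cong (ℕ→ℚ m *_) (ℕ→ℚ-^ m n))

  ℕ→ℚ-mono-≤ : ∀ {m n} → m ℕ.≤ n → ℕ→ℚ m ≤ ℕ→ℚ n
  ℕ→ℚ-mono-≤ {m} {n} m≤n =
    ℚ.toℚᵘ-cancel-≤ (ℚᵘ.≤-respˡ-≃ (ℚᵘ.≃-sym (toℚᵘ-ℕ→ℚ m)) (ℚᵘ.≤-respʳ-≃ (ℚᵘ.≃-sym (toℚᵘ-ℕ→ℚ n))
    (ℚᵘ.*≤* (subst₂ ℤ._≤_ (sym (ℤ.*-identityʳ (+ m))) (sym (ℤ.*-identityʳ (+ n))) (ℤ.+≤+ m≤n)))))

  ℕ→ℚ-cancel-≤ : ∀ {m n} → ℕ→ℚ m ≤ ℕ→ℚ n → m ℕ.≤ n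
  ℕ→ℚ-cancel-≤ {m} {n} le with ℚᵘ.≤-respˡ-≃ (toℚᵘ-ℕ→ℚ m) (ℚᵘ.≤-respʳ-≃ (toℚᵘ-ℕ→ℚ n) (ℚ.toℚᵘ-mono-≤ le))
  ... | ℚᵘ.*≤* h = ℤ.drop‿+≤+ (subst₂ ℤ._≤_ (ℤ.*-identityʳ (+ m)) (ℤ.*-identityʳ (+ n)) h)

  ℕ→ℚ-nonNeg : ∀ n → 0ℚ ≤ ℕ→ℚ n
  ℕ→ℚ-nonNeg n = ℕ→ℚ-mono-≤ {0} {n} z≤n

  ^ℚ-distribʳ-* : ∀ a b n → (a * b) ^ℚ n ≡ a ^ℚ n * b ^ℚ n
  ^ℚ-distribʳ-* a b zero    = sym (ℚ.*-identityˡ 1ℚ)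
  ^ℚ-distribʳ-* a b (suc n) = trans (cong (a * b *_) (^ℚ-distribʳ-* a b n)) (interchange a b (a ^ℚ n) (b ^ℚ n))
    where
    interchange : ∀ a b x y → a * b * (x * y) ≡ a * x * (b * y)
    interchange = solve 4 (λ a b x y → a :* b :* (x :* y) := a :* x :* (b :* y)) refl

  *-nonNeg : ∀ {a b} → 0ℚ ≤ a → 0ℚ ≤ b → 0ℚ ≤ a * b
  *-nonNeg {a} {b} 0≤a 0≤b =
    ℚ.nonNegative⁻¹ (a * b) {{ℚ.nonNeg*nonNeg⇒nonNeg a {{ℚ.nonNegative 0≤a}} b {{ℚ.nonNegative 0≤b}}}}

  ^ℚ-nonNeg : ∀ {a} n → 0ℚ ≤ a → 0ℚ ≤ a ^ℚ n
  ^ℚ-nonNeg zero    _   = ℚ.*≤* (ℤ.+≤+ z≤n)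
  ^ℚ-nonNeg (suc n) 0≤a = *-nonNeg 0≤a (^ℚ-nonNeg n 0≤a)

  ^ℚ-monoˡ-≤ : ∀ {a b} n → 0ℚ ≤ a → a ≤ b → a ^ℚ n ≤ b ^ℚ n
  ^ℚ-monoˡ-≤         zero    _   _   = ℚ.≤-refl
  ^ℚ-monoˡ-≤ {a} {b} (suc n) 0≤a a≤b = ℚ.≤-trans
    (ℚ.*-monoʳ-≤-nonNeg (a ^ℚ n) {{ℚ.nonNegative (^ℚ-nonNeg n 0≤a)}} a≤b)
    (ℚ.*-monoˡ-≤-nonNeg b {{ℚ.nonNegative (ℚ.≤-trans 0≤a a≤b)}} (^ℚ-monoˡ-≤ n 0≤a a≤b))

  scaled-power-bound : ∀ {a} q b s M → 0ℚ ≤ a → a * ℕ→ℚ q ≤ ℕ→ℚ b → ℕ→ℚ s ≤ a ^ℚ M → s ℕ.* q ^ M ℕ.≤ b ^ M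
  scaled-power-bound {a} q b s M 0≤a aq≤b s≤aᴹ = ℕ→ℚ-cancel-≤ (begin
    ℕ→ℚ (s ℕ.* q ^ M)          ≡⟨ trans (ℕ→ℚ-* s (q ^ M)) (cong (ℕ→ℚ s *_) (ℕ→ℚ-^ q M)) ⟩
    ℕ→ℚ s * ℕ→ℚ q ^ℚ M         ≤⟨ ℚ.*-monoʳ-≤-nonNeg (ℕ→ℚ q ^ℚ M) {{ℚ.nonNegative (^ℚ-nonNeg M (ℕ→ℚ-nonNeg q))}} s≤aᴹ ⟩
    a ^ℚ M * ℕ→ℚ q ^ℚ M        ≡⟨ ^ℚ-distribʳ-* a (ℕ→ℚ q) M ⟨
    (a * ℕ→ℚ q) ^ℚ M           ≤⟨ ^ℚ-monoˡ-≤ M (*-nonNeg 0≤a (ℕ→ℚ-nonNeg q)) aq≤b ⟩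
    ℕ→ℚ b ^ℚ M                 ≡⟨ ℕ→ℚ-^ b M ⟨
    ℕ→ℚ (b ^ M)                ∎)
    where open ℚ.≤-Reasoning

  1≤ε*↧ₙε : ∀ ε → 0ℚ < ε → 1ℚ ≤ ε * ℕ→ℚ (↧ₙ ε)
  1≤ε*↧ₙε (mkℚ (+ 0)      _ _) (ℚ.*<* (ℤ.+<+ ()))
  1≤ε*↧ₙε (mkℚ -[1+ _ ]   _ _) (ℚ.*<* ())
  1≤ε*↧ₙε ε@(mkℚ +[1+ n ] d _) _ =
    ℚ.toℚᵘ-cancel-≤ (ℚᵘ.≤-respʳ-≃ (ℚᵘ.≃-sym toℚᵘ-ε*↧ₙε)
      (ℚᵘ.*≤* (subst₂ ℤ._≤_ lhs rhs (ℤ.+≤+ (ℕ.m≤m+n (suc d) (n ℕ.* suc d))))))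
    where
    toℚᵘ-ε*↧ₙε : toℚᵘ (ε * ℕ→ℚ (suc d)) ℚᵘ.≃ ℚᵘ.mkℚᵘ +[1+ n ] d ℚᵘ.* ℚᵘ.mkℚᵘ (+ suc d) 0
    toℚᵘ-ε*↧ₙε = ℚᵘ.≃-trans (ℚ.toℚᵘ-homo-* ε (ℕ→ℚ (suc d)))
                            (ℚᵘ.*-cong (ℚᵘ.≃-refl {ℚᵘ.mkℚᵘ +[1+ n ] d}) (toℚᵘ-ℕ→ℚ (suc d)))
    lhs : + suc d ≡ + 1 ℤ.* + (suc d ℕ.* 1)
    lhs = sym (trans (ℤ.*-identityˡ _) (cong +_ (ℕ.*-identityʳ (suc d))))
    rhs : + (suc d ℕ.+ n ℕ.* suc d) ≡ (+[1+ n ] ℤ.* + suc d) ℤ.* + 1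
    rhs = sym (trans (ℤ.*-identityʳ _) (sym (ℤ.pos-* (suc n) (suc d))))

  [2-ε]*[1+d]≤d+[1+d] : ∀ ε d → 1ℚ ≤ ε * ℕ→ℚ (suc d) → (ℕ→ℚ 2 - ε) * ℕ→ℚ (suc d) ≤ ℕ→ℚ (d ℕ.+ suc d)
  [2-ε]*[1+d]≤d+[1+d] ε d 1≤εq = begin
    (ℕ→ℚ 2 - ε) * Q
      ≡⟨ solve 2 (λ e q → ((con 1ℚ :+ con 1ℚ) :- e) :* q := (q :+ q) :+ (:- (e :* q))) refl ε Q ⟩
    (Q + Q) + - (ε * Q)                    ≡⟨ cong (_+ - (ε * Q)) 2q≡b+1 ⟩
    (ℕ→ℚ b + 1ℚ) + - (ε * Q)               ≤⟨ ℚ.+-monoʳ-≤ (ℕ→ℚ b + 1ℚ) (ℚ.neg-antimono-≤ 1≤εq) ⟩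
    (ℕ→ℚ b + 1ℚ) + - 1ℚ                    ≡⟨ solve 1 (λ x → (x :+ con 1ℚ) :+ (:- con 1ℚ) := x) refl (ℕ→ℚ b) ⟩
    ℕ→ℚ b                                  ∎
    where
    open ℚ.≤-Reasoning
    Q = ℕ→ℚ (suc d)
    b = d ℕ.+ suc d
    2q≡b+1 : Q + Q ≡ ℕ→ℚ b + 1ℚ
    2q≡b+1 = trans (sym (ℕ→ℚ-+ (suc d) (suc d))) (trans (cong ℕ→ℚ (ℕ.+-comm 1 b)) (ℕ→ℚ-+ b 1))

  ε<1⇒0≤2-ε : ∀ ε → ε < 1ℚ → 0ℚ ≤ ℕ→ℚ 2 - ε
  ε<1⇒0≤2-ε ε ε<1 = subst (_≤ ℕ→ℚ 2 - ε) (ℚ.+-inverseʳ ε)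
    (ℚ.+-monoˡ-≤ (- ε) (ℚ.<⇒≤ (ℚ.<-trans ε<1 1<2)))
    where
    1<2 : 1ℚ < ℕ→ℚ 2
    1<2 = ℚ.*<* (ℤ.+<+ (s≤s (s≤s z≤n)))

  1/[1+m] : ℕ → ℚ
  1/[1+m] m = + 1 ℚ./ suc m

  toℚᵘ-1/[1+m] : ∀ m → toℚᵘ (1/[1+m] m) ℚᵘ.≃ ℚᵘ.mkℚᵘ (+ 1) m
  toℚᵘ-1/[1+m] m = ℚ.toℚᵘ-fromℚᵘ (ℚᵘ.mkℚᵘ (+ 1) m)

  1/[1+m]>0 : ∀ m → 0ℚ < 1/[1+m] m
  1/[1+m]>0 m = ℚ.toℚᵘ-cancel-< (ℚᵘ.<-respʳ-≃ (ℚᵘ.≃-sym (toℚᵘ-1/[1+m] m)) (ℚᵘ.*<* (ℤ.+<+ (s≤s z≤n))))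

  1/[1+m]*[1+m]≡1 : ∀ m → 1/[1+m] m * ℕ→ℚ (suc m) ≡ 1ℚ
  1/[1+m]*[1+m]≡1 m = ℚ.toℚᵘ-injective (ℚᵘ.≃-trans (ℚ.toℚᵘ-homo-* (1/[1+m] m) (ℕ→ℚ (suc m)))
    (ℚᵘ.≃-trans (ℚᵘ.*-cong (toℚᵘ-1/[1+m] m) (toℚᵘ-ℕ→ℚ (suc m))) (ℚᵘ.*≡* cross)))
    where
    cross : (+ 1 ℤ.* + suc m) ℤ.* + 1 ≡ + 1 ℤ.* + (suc m ℕ.* 1)
    cross = trans (ℤ.*-identityʳ _) (trans (ℤ.*-identityˡ (+ suc m))
              (trans (cong +_ (sym (ℕ.*-identityʳ (suc m)))) (sym (ℤ.*-identityˡ _))))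

  1/[1+m]*-≤ : ∀ m M e → M ℕ.≤ e ℕ.* suc m → 1/[1+m] m * ℕ→ℚ M ≤ ℕ→ℚ e
  1/[1+m]*-≤ m M e M≤em = begin
    δ * ℕ→ℚ M                     ≤⟨ ℚ.*-monoˡ-≤-nonNeg δ {{ℚ.nonNegative (ℚ.<⇒≤ (1/[1+m]>0 m))}} (ℕ→ℚ-mono-≤ M≤em) ⟩
    δ * ℕ→ℚ (e ℕ.* suc m)         ≡⟨ cong (δ *_) (ℕ→ℚ-* e (suc m)) ⟩
    δ * (ℕ→ℚ e * ℕ→ℚ (suc m))     ≡⟨ solve 3 (λ x y z → x :* (y :* z) := (x :* z) :* y) refl δ (ℕ→ℚ e) (ℕ→ℚ (suc m)) ⟩
    (δ * ℕ→ℚ (suc m)) * ℕ→ℚ e     ≡⟨ cong (_* ℕ→ℚ e) (1/[1+m]*[1+m]≡1 m) ⟩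
    1ℚ * ℕ→ℚ e                    ≡⟨ ℚ.*-identityˡ (ℕ→ℚ e) ⟩
    ℕ→ℚ e                         ∎
    where
    open ℚ.≤-Reasoning
    δ = 1/[1+m] m

theorem5p1 : (ε : ℚ) → 0ℚ < ε → ε < 1ℚ →
    ∃[ δ ] (0ℚ < δ ×
      ((k : ℕ) → k ≥ 1 → (Φ : Graph k → ℚ) → IsoInvariant Φ →
        1 Data.Nat.≤ suppSize Φ →
        ℕ→ℚ (suppSize Φ) ≤ ((ℕ→ℚ 2 - ε) ^ℚ (k C 2)) →
        ∃[ H ] (altEnum Φ H ≢ 0ℚ × δ * ℕ→ℚ (k C 2) ≤ ℕ→ℚ (numEdges H))))
theorem5p1 ε 0<ε ε<1 = 1/[1+m] b , 1/[1+m]>0 b , many-edges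
  where
  -- ↧ₙ ε = suc d, and b = d + suc d is 2 ↧ₙ ε - 1.
  d = ℚ.denominator-1 ε
  b = d ℕ.+ suc d
  1+b≤2[1+d] : suc b ℕ.≤ 2 ℕ.* suc d
  1+b≤2[1+d] = ℕ.≤-reflexive (cong (suc d ℕ.+_) (sym (ℕ.+-identityʳ (suc d))))
  many-edges : (k : ℕ) → k ≥ 1 → (Φ : Graph k → ℚ) → IsoInvariant Φ → 1 Data.Nat.≤ suppSize Φ →
    ℕ→ℚ (suppSize Φ) ≤ ((ℕ→ℚ 2 - ε) ^ℚ (k C 2)) →
    ∃[ H ] (altEnum Φ H ≢ 0ℚ × 1/[1+m] b * ℕ→ℚ (k C 2) ≤ ℕ→ℚ (numEdges H))
  many-edges k _ Φ _ s≥1 s≤ =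
    let H , nonzero , many = nonzero-altEnum-with-many-edges k Φ b (suc d) s≥1 scaled-support 1+b≤2[1+d]
    in H , nonzero , 1/[1+m]*-≤ b (k C 2) (numEdges H) many
    where
    scaled-support : suppSize Φ ℕ.* suc d ^ (k C 2) ℕ.≤ b ^ (k C 2)
    scaled-support = scaled-power-bound (suc d) b (suppSize Φ) (k C 2) (ε<1⇒0≤2-ε ε ε<1)
      ([2-ε]*[1+d]≤d+[1+d] ε d (1≤ε*↧ₙε ε 0<ε)) s≤
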